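{- Consider the following game. A sequence of instructions $n_1,n_2,\dots$ (positive integers) is given, instruction $n_{s+1}$ meaning "change a digit at position $\le n_{s+1}$". A response of player $\gamma$ is a non-decreasing sequence of non-negative dyadic rationals $\gamma_0\le\gamma_1\le\gamma_2\le\cdots$ such that for every $s$, $\lfloor 2^{n_{s+1}}\gamma_{s+1}\rfloor\neq\lfloor 2^{n_{s+1}}\gamma_s\rfloor$ (i.e.\ some binary digit of $\gamma$ at a position $\le n_{s+1}$ changes). The least effort strategy is the response given by $\gamma_{s+1}=(\lfloor 2^{n_{s+1}}\gamma_s\rfloor+1)\cdot 2^{ -n_{s+1}}$ (the least increase that changes a digit at position $\le n_{s+1}$). If $(\gamma_s)$ is produced by the least effort strategy and $(\gamma'_s)$ is any response to the same sequence of instructions with the same initial value $\gamma'_0=\gamma_0$, then $\gamma_s\le\gamma'_s$ for every stage $s$.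
   Context: Binary digit positions are numbered $1,2,3,\dots$ to the right of the binary point, the digit at position $i$ having weight $2^{ -i}$. -}

module Defs where

open import Data.Nat as ℕ using (ℕ; suc; _^_)
open import Data.Nat.Properties using (m^n≢0)
open import Data.Integer as ℤ using (ℤ; +_)
open import Data.Rational using (ℚ; _/_; _*_; _≤_; floor; 0ℚ)
open import Data.Product using (∃-syntax)
open import Relation.Binary.PropositionalEquality using (_≡_; _≢_)

two^ : ℕ → ℚ
two^ k = (+ (2 ^ k)) / 1

_·2^-_ : ℤ → ℕ → ℚ
z ·2^- k = _/_ z (2 ^ k) {{m^n≢0 2 k}}

IsDyadic : ℚ → Set
IsDyadic q = ∃[ k ] ∃[ z ] (q ≡ z ·2^- k)

-- Instructions: n s stands for n_{s+1} (instruction given at stage s+1).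
-- A response γ to instructions n.
record IsResponse (n : ℕ → ℕ) (γ : ℕ → ℚ) : Set where
  field
    nonneg   : ∀ s → 0ℚ ≤ γ s
    dyadic   : ∀ s → IsDyadic (γ s)
    monotone : ∀ s → γ s ≤ γ (suc s)
    changes  : ∀ s → floor (two^ (n s) * γ (suc s)) ≢ floor (two^ (n s) * γ s)

LeastEffort : (n : ℕ → ℕ) (γ : ℕ → ℚ) → Set
LeastEffort n γ = ∀ s → γ (suc s) ≡ (floor (two^ (n s) * γ s) ℤ.+ + 1) ·2^- n s

-- A response γ′ at least as large as γ before stage s+1 has
-- ⌊2^N γ s⌋ ≤ ⌊2^N γ′ s⌋ < ⌊2^N γ′ (s+1)⌋ (with N = n_{s+1}), the strict step because a digit
-- at a position ≤ N changes. Hence 2^N γ′ (s+1) ≥ ⌊2^N γ s⌋ + 1, which is exactly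
-- 2^N γ (s+1) for the least effort strategy; induction on s finishes the argument.
module Submission where

open import Defs
open import Data.Nat using (ℕ; suc; _≥_)
open import Data.Rational using (ℚ; _≤_)
open import Relation.Binary.PropositionalEquality using (_≡_)

open import Data.Nat as ℕ using (zero)
import Data.Nat.Properties as ℕ
open import Data.Integer as ℤ using (+_)
import Data.Integer.Properties as ℤ
open import Data.Integer.DivMod using ([n/d]*d≤n; n<s[n/ℕd]*d; div-pos-is-/ℕ)
open import Data.Rational as ℚ using (floor; toℚᵘ)
import Data.Rational.Properties as ℚ
open import Data.Rational.Unnormalised as ℚᵘ using (mkℚᵘ; *≤*)
import Data.Rational.Unnormalised.Properties as ℚᵘ
open import Relation.Binary.PropositionalEquality using (_≢_; refl; sym; cong; subst; ≢-sym)

≤-floorᵘ⇒≤ : ∀ {w} u → w ℤ.≤ ℚᵘ.floor u → w ℚᵘ./ 1 ℚᵘ.≤ u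
≤-floorᵘ⇒≤ {w} (mkℚᵘ a b) w≤⌊u⌋ = *≤* (begin
  w ℤ.* d          ≤⟨ ℤ.*-monoʳ-≤-nonNeg d w≤⌊u⌋ ⟩
  (a ℤ./ d) ℤ.* d  ≤⟨ [n/d]*d≤n a d ⟩
  a                ≡⟨ ℤ.*-identityʳ a ⟨
  a ℤ.* + 1        ∎)
  where
  open ℤ.≤-Reasoning
  d = + suc b

≤⇒≤-floorᵘ : ∀ {w} u → w ℚᵘ./ 1 ℚᵘ.≤ u → w ℤ.≤ ℚᵘ.floor u
≤⇒≤-floorᵘ {w} (mkℚᵘ a b) (*≤* wd≤a) = ℤ.≮⇒≥ λ ⌊u⌋<w →
  ℤ.<⇒≱ (a<wd (subst (ℤ._< w) (div-pos-is-/ℕ a (suc b)) ⌊u⌋<w))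
        (ℤ.≤-trans wd≤a (ℤ.≤-reflexive (ℤ.*-identityʳ a)))
  where
  open ℤ.≤-Reasoning
  d = + suc b
  a<wd : a ℤ./ℕ suc b ℤ.< w → a ℤ.< w ℤ.* d
  a<wd q<w = begin-strict
    a                             <⟨ n<s[n/ℕd]*d a (suc b) ⟩
    ℤ.suc (a ℤ./ℕ suc b) ℤ.* d    ≤⟨ ℤ.*-monoʳ-≤-nonNeg d (ℤ.i<j⇒suc[i]≤j q<w) ⟩
    w ℤ.* d                       ∎

floorᵘ-mono-≤ : ∀ {u v} → u ℚᵘ.≤ v → ℚᵘ.floor u ℤ.≤ ℚᵘ.floor v
floorᵘ-mono-≤ {u} {v} u≤v = ≤⇒≤-floorᵘ v (ℚᵘ.≤-trans (≤-floorᵘ⇒≤ u ℤ.≤-refl) u≤v)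

≤-*⇒/-≤ : ∀ w d .{{_ : ℕ.NonZero d}} x →
          w ℚᵘ./ 1 ℚᵘ.≤ (+ d ℚᵘ./ 1) ℚᵘ.* x → w ℚᵘ./ d ℚᵘ.≤ x
≤-*⇒/-≤ w (suc d) (mkℚᵘ a b) (*≤* le) = *≤* (begin
  w ℤ.* + suc b               ≡⟨ cong (λ m → w ℤ.* + m) (ℕ.*-identityˡ (suc b)) ⟨
  w ℤ.* + (1 ℕ.* suc b)       ≤⟨ le ⟩
  (+ suc d ℤ.* a) ℤ.* + 1     ≡⟨ ℤ.*-identityʳ _ ⟩
  + suc d ℤ.* a               ≡⟨ ℤ.*-comm (+ suc d) a ⟩
  a ℤ.* + suc d               ∎)
  where open ℤ.≤-Reasoning

floor≡floorᵘ : ∀ q → floor q ≡ ℚᵘ.floor (toℚᵘ q)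
floor≡floorᵘ (ℚ.mkℚ _ _ _) = refl

floor-mono-≤ : ∀ {p q} → p ≤ q → floor p ℤ.≤ floor q
floor-mono-≤ {p} {q} p≤q
  rewrite floor≡floorᵘ p | floor≡floorᵘ q = floorᵘ-mono-≤ (ℚ.toℚᵘ-mono-≤ p≤q)

toℚᵘ-/ : ∀ z d .{{_ : ℕ.NonZero d}} → toℚᵘ (z ℚ./ d) ℚᵘ.≃ z ℚᵘ./ d
toℚᵘ-/ z (suc d) = ℚ.toℚᵘ-fromℚᵘ (mkℚᵘ z d)

≤-floor-*⇒/-≤ : ∀ w d .{{_ : ℕ.NonZero d}} x →
                w ℤ.≤ floor ((+ d ℚ./ 1) ℚ.* x) → w ℚ./ d ≤ x
≤-floor-*⇒/-≤ w d x w≤⌊dx⌋ = ℚ.toℚᵘ-cancel-≤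
  (ℚᵘ.≤-respˡ-≃ (ℚᵘ.≃-sym (toℚᵘ-/ w d)) (≤-*⇒/-≤ w d (toℚᵘ x)
    (ℚᵘ.≤-respʳ-≃ toℚᵘ[dx]≃dx (≤-floorᵘ⇒≤ (toℚᵘ dx) (subst (w ℤ.≤_) (floor≡floorᵘ dx) w≤⌊dx⌋)))))
  where
  dx = (+ d ℚ./ 1) ℚ.* x
  toℚᵘ[dx]≃dx : toℚᵘ dx ℚᵘ.≃ (+ d ℚᵘ./ 1) ℚᵘ.* toℚᵘ x
  toℚᵘ[dx]≃dx = ℚᵘ.≃-trans (ℚ.toℚᵘ-homo-* (+ d ℚ./ 1) x) (ℚᵘ.*-congʳ (toℚᵘ-/ (+ d) 1))

least-increase-≤ : ∀ d .{{_ : ℕ.NonZero d}} {x x′ y} → x ≤ x′ → x′ ≤ y →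
                   floor ((+ d ℚ./ 1) ℚ.* y) ≢ floor ((+ d ℚ./ 1) ℚ.* x′) →
                   (floor ((+ d ℚ./ 1) ℚ.* x) ℤ.+ + 1) ℚ./ d ≤ y
least-increase-≤ d {x} {x′} {y} x≤x′ x′≤y ⌊dy⌋≢⌊dx′⌋ = ≤-floor-*⇒/-≤ _ d y
  (subst (ℤ._≤ floor (scale y)) (ℤ.+-comm (+ 1) (floor (scale x))) (ℤ.i<j⇒suc[i]≤j ⌊dx⌋<⌊dy⌋))
  where
  open ℤ.≤-Reasoning
  scale : ℚ → ℚ
  scale q = (+ d ℚ./ 1) ℚ.* q
  scale-mono : ∀ {p q} → p ≤ q → scale p ≤ scale q
  scale-mono = ℚ.*-monoˡ-≤-nonNeg (+ d ℚ./ 1) {{ℚ.normalize-nonNeg d 1}}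
  ⌊dx⌋<⌊dy⌋ : floor (scale x) ℤ.< floor (scale y)
  ⌊dx⌋<⌊dy⌋ = begin-strict
    floor (scale x)   ≤⟨ floor-mono-≤ (scale-mono x≤x′) ⟩
    floor (scale x′)  <⟨ ℤ.≤∧≢⇒< (floor-mono-≤ (scale-mono x′≤y)) (≢-sym ⌊dy⌋≢⌊dx′⌋) ⟩
    floor (scale y)   ∎

lemma3p2 : (n : ℕ → ℕ) → (∀ s → n s ≥ 1) →
    (γ γ′ : ℕ → ℚ) → IsResponse n γ → LeastEffort n γ →
    IsResponse n γ′ → γ′ 0 ≡ γ 0 →
    ∀ s → γ s ≤ γ′ s
lemma3p2 n _ γ γ′ _ leastEffort γ′-response γ′0≡γ0 zero = ℚ.≤-reflexive (sym γ′0≡γ0)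
lemma3p2 n n≥1 γ γ′ γ-response leastEffort γ′-response γ′0≡γ0 (suc s)
  rewrite leastEffort s =
  least-increase-≤ (2 ℕ.^ n s) {{ℕ.m^n≢0 2 (n s)}}
    (lemma3p2 n n≥1 γ γ′ γ-response leastEffort γ′-response γ′0≡γ0 s)
    (IsResponse.monotone γ′-response s)
    (IsResponse.changes γ′-response s)
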